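{- (i) Let $S$ be the group of all permutations of a countably infinite set $X$. Then $S$ does not embed (as a subgroup) in any pseudofinite group. (ii) There is a finitely generated group which does not embed in any pseudofinite group.
   Context: A pseudofinite group is an infinite group which satisfies every first-order sentence in the language of groups $(\cdot,{}^{ -1},1)$ that is true in all finite groups. -}

module Defs where

open import Level using (Level; _⊔_; 0ℓ; Setω)
open import Data.Nat using (ℕ; suc)
open import Data.Fin using (Fin; zero; suc)
open import Data.Product using (Σ; _×_; _,_)
open import Data.Sum using (_⊎_)
open import Data.Empty using (⊥)
open import Data.List using (List)
open import Relation.Nullary using (¬_)
open import Relation.Binary.PropositionalEquality
  using (_≡_; refl; sym; trans; cong; isEquivalence)
open import Algebra.Bundles using (Group; RawGroup)
open import Algebra.Morphism.Structures using (module GroupMorphisms)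

data Term (n : ℕ) : Set where
  var  : Fin n → Term n
  _·_  : Term n → Term n → Term n
  inv  : Term n → Term n
  one  : Term n

data Formula (n : ℕ) : Set where
  _≐_  : Term n → Term n → Formula n
  ⊥f   : Formula n
  _⇒_  : Formula n → Formula n → Formula n
  _∧f_ : Formula n → Formula n → Formula n
  _∨f_ : Formula n → Formula n → Formula n
  ∀f   : Formula (suc n) → Formula n
  ∃f   : Formula (suc n) → Formula n

Sentence : Set
Sentence = Formula 0

-- Classical (Tarskian) satisfaction, rendered constructively via the
-- Gödel–Gentzen double-negation translation (classically equivalent
-- to the usual satisfaction relation).
module Semantics {c ℓ : Level} (G : Group c ℓ) where
  open Group G

  Env : ℕ → Set c
  Env n = Fin n → Carrier

  extend : ∀ {n} → Carrier → Env n → Env (suc n)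
  extend a ρ zero    = a
  extend a ρ (suc i) = ρ i

  evalT : ∀ {n} → Env n → Term n → Carrier
  evalT ρ (var i) = ρ i
  evalT ρ (t · s) = evalT ρ t ∙ evalT ρ s
  evalT ρ (inv t) = evalT ρ t ⁻¹
  evalT ρ one     = ε

  sat : ∀ {n} → Env n → Formula n → Set (c ⊔ ℓ)
  sat ρ (t ≐ s)  = ¬ ¬ Level.Lift c (evalT ρ t ≈ evalT ρ s)
  sat ρ ⊥f       = Level.Lift (c ⊔ ℓ) ⊥
  sat ρ (φ ⇒ ψ)  = sat ρ φ → sat ρ ψ
  sat ρ (φ ∧f ψ) = sat ρ φ × sat ρ ψ
  sat ρ (φ ∨f ψ) = ¬ ¬ (sat ρ φ ⊎ sat ρ ψ)
  sat ρ (∀f φ)   = (a : Carrier) → sat (extend a ρ) φ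
  sat ρ (∃f φ)   = ¬ ¬ (Σ Carrier λ a → sat (extend a ρ) φ)

  emptyEnv : Env 0
  emptyEnv ()

_⊨_ : ∀ {c ℓ} → Group c ℓ → Sentence → Set (c ⊔ ℓ)
G ⊨ φ = Semantics.sat G (Semantics.emptyEnv G) φ

IsFinite : ∀ {c ℓ} → Group c ℓ → Set (c ⊔ ℓ)
IsFinite G = Σ ℕ λ n → Σ (Fin n → Carrier) λ f → ∀ x → Σ (Fin n) λ i → f i ≈ x
  where open Group G

IsInfinite : ∀ {c ℓ} → Group c ℓ → Set (c ⊔ ℓ)
IsInfinite G = ¬ IsFinite G

-- every finite group is isomorphic to one on level 0 (e.g. on some Fin n),
-- so quantifying over finite groups in Group 0ℓ 0ℓ loses nothing.
TrueInAllFiniteGroups : Sentence → Set₁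
TrueInAllFiniteGroups φ = (F : Group 0ℓ 0ℓ) → IsFinite F → F ⊨ φ

IsPseudofinite : ∀ {c ℓ} → Group c ℓ → Set (Level.suc 0ℓ ⊔ c ⊔ ℓ)
IsPseudofinite G = IsInfinite G × ((φ : Sentence) → TrueInAllFiniteGroups φ → G ⊨ φ)

Embeds : ∀ {a ℓ₁ b ℓ₂} → Group a ℓ₁ → Group b ℓ₂ → Set (a ⊔ b ⊔ ℓ₁ ⊔ ℓ₂)
Embeds H G = Σ (Group.Carrier H → Group.Carrier G)
  (GroupMorphisms.IsGroupMonomorphism (Group.rawGroup H) (Group.rawGroup G))

EmbedsInPseudofinite : ∀ {a ℓ₁} (c ℓ : Level) → Group a ℓ₁ → Set _
EmbedsInPseudofinite c ℓ H = Σ (Group c ℓ) λ G → IsPseudofinite G × Embeds H G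

data Word (n : ℕ) : Set where
  gen  : Fin n → Word n
  _·w_ : Word n → Word n → Word n
  invw : Word n → Word n
  onew : Word n

evalW : ∀ {c ℓ} (G : Group c ℓ) {n} → (Fin n → Group.Carrier G) → Word n → Group.Carrier G
evalW G g (gen i)  = g i
evalW G g (u ·w v) = Group._∙_ G (evalW G g u) (evalW G g v)
evalW G g (invw u) = Group._⁻¹ G (evalW G g u)
evalW G g onew     = Group.ε G

FinitelyGenerated : ∀ {c ℓ} → Group c ℓ → Set (c ⊔ ℓ)
FinitelyGenerated G = Σ ℕ λ n → Σ (Fin n → Group.Carrier G) λ g →
  ∀ x → Σ (Word n) λ w → Group._≈_ G (evalW G g w) x

record Perm (X : Set) : Set where
  field
    to      : X → X
    from    : X → X
    to-from : ∀ x → to (from x) ≡ x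
    from-to : ∀ x → from (to x) ≡ x
open Perm

module _ (X : Set) where
  private
    _≈p_ : Perm X → Perm X → Set
    f ≈p g = ∀ x → to f x ≡ to g x

    _∘p_ : Perm X → Perm X → Perm X
    f ∘p g = record
      { to = λ x → to f (to g x)
      ; from = λ x → from g (from f x)
      ; to-from = λ x → trans (cong (to f) (to-from g (from f x))) (to-from f x)
      ; from-to = λ x → trans (cong (from g) (from-to f (to g x))) (from-to g x) }

    idp : Perm X
    idp = record { to = λ x → x ; from = λ x → x
                 ; to-from = λ _ → refl ; from-to = λ _ → refl }

    invp : Perm X → Perm X
    invp f = record { to = from f ; from = to f
                    ; to-from = from-to f ; from-to = to-from f }

    inv-cong : ∀ {f g} → f ≈p g → invp f ≈p invp g
    inv-cong {f} {g} e x =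
      trans (sym (from-to g (from f x)))
            (cong (from g) (trans (sym (e (from f x))) (to-from f x)))

  Sym : Group 0ℓ 0ℓ
  Sym = record
    { Carrier = Perm X
    ; _≈_ = _≈p_
    ; _∙_ = _∘p_
    ; ε = idp
    ; _⁻¹ = invp
    ; isGroup = record
      { isMonoid = record
        { isSemigroup = record
          { isMagma = record
            { isEquivalence = record
              { refl = λ _ → refl
              ; sym = λ e x → sym (e x)
              ; trans = λ e₁ e₂ x → trans (e₁ x) (e₂ x) }
            ; ∙-cong = λ {f} {f'} {g} {g'} e₁ e₂ x →
                trans (cong (to f) (e₂ x)) (e₁ (to g' x)) }
          ; assoc = λ _ _ _ _ → refl }
        ; identity = (λ _ _ → refl) , (λ _ _ → refl) }
      ; inverse = (λ f x → from-to f x) , (λ f x → to-from f x)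
      ; ⁻¹-cong = λ {f} {g} → inv-cong {f} {g} } }

-- Setω-valued product / dependent sum (needed because the statements
-- quantify over all universe levels of the target pseudofinite group)

record _×ω_ (A B : Setω) : Setω where
  constructor _,ω_
  field
    fstω : A
    sndω : B

record Σω (A : Set₁) (B : A → Setω) : Setω where
  constructor _,ω_
  field
    witness : A
    proof   : B witness

record _∧ω_ {a} (A : Set a) (B : Setω) : Setω where
  constructor _,ω_
  field
    fst∧ : A
    snd∧ : B

module Submission where

-- Call a triple (a, t, s) of group elements an obstruction if t a t⁻¹ = a²
-- and s commutes with a² but not with a.  The sentence
--     φ := ∀x y z. y x = x² y → z x² = x² z → z x = x z
-- says exactly that there is no obstruction.  φ holds in every finite group:
-- a has some order, repeatedly halving an even exponent (aᵏ is conjugate to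
-- a²ᵏ) yields an odd exponent 2k + 1, and then a = (a²)ᵏ⁺¹ lies in every
-- centraliser of a².  Hence a pseudofinite group satisfies φ, and since an
-- injective homomorphism carries obstructions forward, no group containing
-- an obstruction embeds in a pseudofinite group.
--
-- We then build an obstruction in Sym(Y) for Y = ℤ × ℕ: a shifts each copy
-- of ℤ, t spreads copy 2q + b of ℤ over the residues b (mod 2) of copy q, and
-- s swaps 2w with 2w + 1.  Part (i) follows because Y ≅ ℕ ≅ X and Sym is
-- functorial in bijections; part (ii) because the obstruction already lives
-- in the subgroup of Sym(Y) generated by a, t and s.

open import Defs
open import Level using (Level; 0ℓ; _⊔_; lift; lower)
open import Data.Bool using (Bool; true; false; not)
open import Data.Bool.Properties using (not-involutive)
open import Data.Nat using (ℕ; zero; suc; _*_; _<_; s≤s)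
import Data.Nat as ℕ
open import Data.Nat.Properties using (m≤m*n; n<1+n; m≤n⇒∃[o]m+o≡n; +-suc)
open import Data.Nat.Induction using (<-rec)
open import Data.Nat.Binary using (ℕᵇ; 2[1+_]; 1+[2_]) renaming (zero to zeroᵇ)
import Data.Nat.Binary as ℕᵇ
import Data.Nat.Binary.Properties as ℕᵇ
open import Data.Integer using (ℤ; +_; -[1+_])
import Data.Integer as ℤ
import Data.Integer.Properties as ℤ
open import Data.Fin using (Fin; toℕ)
import Data.Fin as Fin
open import Data.Fin.Properties using (pigeonhole)
open import Data.Product using (Σ; _×_; _,_; proj₁; proj₂; map₁; map₂)
open import Data.Product.Function.NonDependent.Propositional using (_×-↔_)
open import Relation.Nullary using (¬_)
open import Relation.Binary.PropositionalEquality
  using (_≡_; refl; sym; cong; cong₂; module ≡-Reasoning)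
import Relation.Binary.Construct.On as On
open import Function.Bundles using (_↔_; Inverse; mk↔ₛ′)
open import Function.Properties.Inverse using (↔-refl; ↔-sym; ↔-trans)
open import Algebra.Bundles using (Group)
open import Algebra.Morphism.Structures using (module GroupMorphisms)
import Algebra.Properties.Group as GroupProperties
import Algebra.Properties.Monoid.Mult as MonoidMult
import Relation.Binary.Reasoning.Setoid as SetoidReasoning

data Parity : ℕ → Set where
  even : ∀ k → Parity (k * 2)
  odd  : ∀ k → Parity (suc (k * 2))

parity : ∀ n → Parity n
parity zero = even zero
parity (suc n) with parity n
... | even k = odd k
... | odd k  = even (suc k)

module Powers {c ℓ : Level} (G : Group c ℓ) where
  open Group G renaming (sym to ≈-sym; trans to ≈-trans)
  open GroupProperties G using (∙-cancelˡ)
  open MonoidMult monoid using (×-congʳ; ×-homo-+; ×-assocˡ) renaming (_×_ to pow)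
  open SetoidReasoning setoid

  intertwine-pow : ∀ {t x y} → t ∙ x ≈ y ∙ t → ∀ n → t ∙ pow n x ≈ pow n y ∙ t
  intertwine-pow {t} {x} {y} tx≈yt zero = ≈-trans (identityʳ t) (≈-sym (identityˡ t))
  intertwine-pow {t} {x} {y} tx≈yt (suc n) = begin
    t ∙ (x ∙ pow n x)   ≈⟨ assoc t x (pow n x) ⟨
    (t ∙ x) ∙ pow n x   ≈⟨ ∙-congʳ tx≈yt ⟩
    (y ∙ t) ∙ pow n x   ≈⟨ assoc y t (pow n x) ⟩
    y ∙ (t ∙ pow n x)   ≈⟨ ∙-congˡ (intertwine-pow tx≈yt n) ⟩
    y ∙ (pow n y ∙ t)   ≈⟨ assoc y (pow n y) t ⟨
    (y ∙ pow n y) ∙ t   ∎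

  pow-square : ∀ x k → pow k (x ∙ x) ≈ pow (k * 2) x
  pow-square x k = ≈-trans (×-congʳ k (∙-congˡ (≈-sym (identityʳ x)))) (×-assocˡ x k 2)

  HasOddExponent : Carrier → Set ℓ
  HasOddExponent a = Σ ℕ λ k → pow (suc (k * 2)) a ≈ ε

  module _ {a t : Carrier} (ta≈a²t : t ∙ a ≈ (a ∙ a) ∙ t) where

    -- If a²ᵏ = 1 then aᵏ = 1, because t aᵏ t⁻¹ = a²ᵏ.
    halve-exponent : ∀ k → pow (k * 2) a ≈ ε → pow k a ≈ ε
    halve-exponent k a²ᵏ≈ε = ∙-cancelˡ t (pow k a) ε (begin
      t ∙ pow k a            ≈⟨ intertwine-pow ta≈a²t k ⟩
      pow k (a ∙ a) ∙ t      ≈⟨ ∙-congʳ (≈-trans (pow-square a k) a²ᵏ≈ε) ⟩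
      ε ∙ t                  ≈⟨ identityˡ t ⟩
      t                      ≈⟨ identityʳ t ⟨
      t ∙ ε                  ∎)

    odd-exponent : ∀ n → pow (suc n) a ≈ ε → HasOddExponent a
    odd-exponent = <-rec _ step
      where
      step : ∀ n → (∀ {m} → m < n → pow (suc m) a ≈ ε → HasOddExponent a) →
             pow (suc n) a ≈ ε → HasOddExponent a
      step n rec aⁿ⁺¹≈ε with parity n
      ... | even k = k , aⁿ⁺¹≈ε
      ... | odd k  = rec (s≤s (m≤m*n k 2)) (halve-exponent (suc k) aⁿ⁺¹≈ε)

  power-of-square : ∀ a k → pow (suc (k * 2)) a ≈ ε → a ≈ pow (suc k) (a ∙ a)
  power-of-square a k a²ᵏ⁺¹≈ε = begin
    a                        ≈⟨ identityʳ a ⟨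
    a ∙ ε                    ≈⟨ ∙-congˡ a²ᵏ⁺¹≈ε ⟨
    a ∙ pow (suc (k * 2)) a  ≈⟨ pow-square a (suc k) ⟨
    pow (suc k) (a ∙ a)      ∎

  period : ∀ a {i j} → i < j → pow i a ≈ pow j a → Σ ℕ λ d → pow (suc d) a ≈ ε
  period a {i} i<j aⁱ≈aʲ with m≤n⇒∃[o]m+o≡n i<j
  ... | d , refl = d , ≈-sym (∙-cancelˡ (pow i a) ε (pow (suc d) a) (begin
    pow i a ∙ ε              ≈⟨ identityʳ (pow i a) ⟩
    pow i a                  ≈⟨ aⁱ≈aʲ ⟩
    pow (suc (i ℕ.+ d)) a    ≡⟨ cong (λ m → pow m a) (+-suc i d) ⟨
    pow (i ℕ.+ suc d) a      ≈⟨ ×-homo-+ a i (suc d) ⟩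
    pow i a ∙ pow (suc d) a  ∎))

  -- In a finite group every element has finite order (pigeonhole on a⁰, …, aⁿ).
  finite⇒torsion : IsFinite G → ∀ a → Σ ℕ λ d → pow (suc d) a ≈ ε
  finite⇒torsion (n , enum , onto) a
    with pigeonhole (n<1+n n) (λ i → proj₁ (onto (pow (toℕ i) a)))
  ... | i , j , i<j , same-index = period a i<j (begin
    pow (toℕ i) a                       ≈⟨ proj₂ (onto (pow (toℕ i) a)) ⟨
    enum (proj₁ (onto (pow (toℕ i) a))) ≡⟨ cong enum same-index ⟩
    enum (proj₁ (onto (pow (toℕ j) a))) ≈⟨ proj₂ (onto (pow (toℕ j) a)) ⟩
    pow (toℕ j) a                       ∎)

  centraliser-of-square : IsFinite G → ∀ {a t s} → t ∙ a ≈ (a ∙ a) ∙ t →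
                          s ∙ (a ∙ a) ≈ (a ∙ a) ∙ s → s ∙ a ≈ a ∙ s
  centraliser-of-square fin {a} {t} {s} ta≈a²t sa²≈a²s
    with finite⇒torsion fin a
  ... | d , aᵈ⁺¹≈ε with odd-exponent ta≈a²t d aᵈ⁺¹≈ε
  ... | k , a²ᵏ⁺¹≈ε = begin
    s ∙ a                     ≈⟨ ∙-congˡ a≈a²ᵏ⁺² ⟩
    s ∙ pow (suc k) (a ∙ a)   ≈⟨ intertwine-pow sa²≈a²s (suc k) ⟩
    pow (suc k) (a ∙ a) ∙ s   ≈⟨ ∙-congʳ a≈a²ᵏ⁺² ⟨
    a ∙ s                     ∎
    where
    a≈a²ᵏ⁺² : a ≈ pow (suc k) (a ∙ a)
    a≈a²ᵏ⁺² = power-of-square a k a²ᵏ⁺¹≈ε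

record Obstruction {c ℓ : Level} (G : Group c ℓ) : Set (c ⊔ ℓ) where
  open Group G
  field
    a t s              : Carrier
    conjugates-square  : t ∙ a ≈ (a ∙ a) ∙ t
    centralises-square : s ∙ (a ∙ a) ≈ (a ∙ a) ∙ s
    not-centralises    : ¬ (s ∙ a ≈ a ∙ s)

φ : Sentence
φ = ∀f (∀f (∀f (((y · x) ≐ ((x · x) · y)) ⇒ (((z · (x · x)) ≐ ((x · x) · z)) ⇒ ((z · x) ≐ (x · z))))))
  where
  x y z : Term 3
  x = var (Fin.suc (Fin.suc Fin.zero))
  y = var (Fin.suc Fin.zero)
  z = var Fin.zero

finite⊨φ : TrueInAllFiniteGroups φ
finite⊨φ F fin a t s ¬¬ta≈a²t ¬¬sa²≈a²s ¬sa≉as =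
  ¬¬ta≈a²t λ ta≈a²t → ¬¬sa²≈a²s λ sa²≈a²s →
    ¬sa≉as (lift (Powers.centraliser-of-square F fin (lower ta≈a²t) (lower sa²≈a²s)))

⊨φ⇒¬obstruction : ∀ {c ℓ} {G : Group c ℓ} → G ⊨ φ → ¬ Obstruction G
⊨φ⇒¬obstruction G⊨φ O = G⊨φ a t s (λ k → k (lift conjugates-square))
                                   (λ k → k (lift centralises-square))
                                   (λ e → not-centralises (lower e))
  where open Obstruction O

obstruction-transport : ∀ {a ℓ₁ b ℓ₂} {H : Group a ℓ₁} {G : Group b ℓ₂} → Embeds H G →
                        Obstruction H → Obstruction G
obstruction-transport {H = H} {G} (f , f-mono) O = record
  { a = f a ; t = f t ; s = f s
  ; conjugates-square  = ≈-trans (image conjugates-square) (∙-congʳ (∙-homo a a))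
  ; centralises-square = ≈-trans (∙-congˡ (≈-sym (∙-homo a a)))
                               (≈-trans (image centralises-square) (∙-congʳ (∙-homo a a)))
  ; not-centralises    = λ e → not-centralises (injective (preimage e)) }
  where
  open Obstruction O
  open Group G renaming (sym to ≈-sym; trans to ≈-trans)
  module H = Group H
  open GroupMorphisms.IsGroupMonomorphism f-mono
  image : ∀ {x y z w} → x H.∙ y H.≈ z H.∙ w → f x ∙ f y ≈ f z ∙ f w
  image {x} {y} {z} {w} e = ≈-trans (≈-sym (∙-homo x y)) (≈-trans (⟦⟧-cong e) (∙-homo z w))
  preimage : ∀ {x y z w} → f x ∙ f y ≈ f z ∙ f w → f (x H.∙ y) ≈ f (z H.∙ w)
  preimage {x} {y} {z} {w} e = ≈-trans (∙-homo x y) (≈-trans e (≈-sym (∙-homo z w)))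

-- A group with an obstruction embeds in no pseudofinite group: the latter
-- satisfies φ, and the image of the obstruction would refute it.
obstruction⇒¬embeds : ∀ {a ℓ₁} {H : Group a ℓ₁} → Obstruction H →
                      (c ℓ : Level) → ¬ EmbedsInPseudofinite c ℓ H
obstruction⇒¬embeds O c ℓ (G , (_ , G⊨finite-truths) , H↪G) =
  ⊨φ⇒¬obstruction {G = G} (G⊨finite-truths φ finite⊨φ) (obstruction-transport H↪G O)

-- A bijection X ≅ Y induces an embedding Sym Y ↪ Sym X by conjugation.
Sym-embedding : ∀ {X Y : Set} → X ↔ Y → Embeds (Sym Y) (Sym X)
Sym-embedding {X} {Y} e = pullback , record
  { isGroupHomomorphism = record
    { isMonoidHomomorphism = record
      { isMagmaHomomorphism = record
        { isRelHomomorphism = record { cong = λ p≈q x → cong from (p≈q (to x)) }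
        ; homo = λ p q x → cong (λ y → from (Perm.to p y)) (sym (strictlyInverseˡ _)) }
      ; ε-homo = strictlyInverseʳ }
    ; ⁻¹-homo = λ p x → refl }
  ; injective = λ {p} {q} → pullback-injective {p} {q} }
  where
  open Inverse e
  pullback : Perm Y → Perm X
  pullback p = record
    { to   = λ x → from (Perm.to p (to x))
    ; from = λ x → from (Perm.from p (to x))
    ; to-from = λ x → begin
        from (Perm.to p (to (from (Perm.from p (to x))))) ≡⟨ cong (λ y → from (Perm.to p y)) (strictlyInverseˡ _) ⟩
        from (Perm.to p (Perm.from p (to x)))             ≡⟨ cong from (Perm.to-from p (to x)) ⟩
        from (to x)                                        ≡⟨ strictlyInverseʳ x ⟩
        x                                                  ∎
    ; from-to = λ x → begin
        from (Perm.from p (to (from (Perm.to p (to x))))) ≡⟨ cong (λ y → from (Perm.from p y)) (strictlyInverseˡ _) ⟩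
        from (Perm.from p (Perm.to p (to x)))             ≡⟨ cong from (Perm.from-to p (to x)) ⟩
        from (to x)                                        ≡⟨ strictlyInverseʳ x ⟩
        x                                                  ∎ }
    where open ≡-Reasoning
  pullback-injective : ∀ {p q} → (∀ x → from (Perm.to p (to x)) ≡ from (Perm.to q (to x))) →
                       ∀ y → Perm.to p y ≡ Perm.to q y
  pullback-injective {p} {q} eq y = begin
    Perm.to p y                       ≡⟨ strictlyInverseˡ _ ⟨
    to (from (Perm.to p y))           ≡⟨ cong (λ y′ → to (from (Perm.to p y′))) (strictlyInverseˡ y) ⟨
    to (from (Perm.to p (to (from y)))) ≡⟨ cong to (eq (from y)) ⟩
    to (from (Perm.to q (to (from y)))) ≡⟨ cong (λ y′ → to (from (Perm.to q y′))) (strictlyInverseˡ y) ⟩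
    to (from (Perm.to q y))           ≡⟨ strictlyInverseˡ _ ⟩
    Perm.to q y                       ∎
    where open ≡-Reasoning

-- The subgroup of G generated by g : Fin n → G, presented as words in the
-- generators identified when they evaluate to equal elements of G.
module _ {c ℓ : Level} (G : Group c ℓ) {n : ℕ} (g : Fin n → Group.Carrier G) where
  private
    module G = Group G
    ev : Word n → G.Carrier
    ev = evalW G g

  Generated : Group 0ℓ ℓ
  Generated = record
    { Carrier = Word n
    ; _≈_     = λ u v → ev u G.≈ ev v
    ; _∙_     = _·w_
    ; ε       = onew
    ; _⁻¹     = invw
    ; isGroup = record
      { isMonoid = record
        { isSemigroup = record
          { isMagma = record
            { isEquivalence = On.isEquivalence ev G.isEquivalence
            ; ∙-cong        = G.∙-cong }
          ; assoc = λ u v w → G.assoc (ev u) (ev v) (ev w) }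
        ; identity = (λ u → G.identityˡ (ev u)) , (λ u → G.identityʳ (ev u)) }
      ; inverse = (λ u → G.inverseˡ (ev u)) , (λ u → G.inverseʳ (ev u))
      ; ⁻¹-cong = G.⁻¹-cong } }

  evalW-gen : ∀ w → evalW Generated gen w ≡ w
  evalW-gen (gen i)  = refl
  evalW-gen (u ·w v) = cong₂ _·w_ (evalW-gen u) (evalW-gen v)
  evalW-gen (invw u) = cong invw (evalW-gen u)
  evalW-gen onew     = refl

  Generated-finitelyGenerated : FinitelyGenerated Generated
  Generated-finitelyGenerated =
    n , gen , λ w → w , G.reflexive (cong ev (evalW-gen w))

obstruction-triple : ∀ {c ℓ} {G : Group c ℓ} → Obstruction G → Fin 3 → Group.Carrier G
obstruction-triple O Fin.zero                    = Obstruction.a O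
obstruction-triple O (Fin.suc Fin.zero)          = Obstruction.t O
obstruction-triple O (Fin.suc (Fin.suc Fin.zero)) = Obstruction.s O

obstruction-generated : ∀ {c ℓ} {G : Group c ℓ} (O : Obstruction G) →
                        Obstruction (Generated G (obstruction-triple O))
obstruction-generated O = record
  { a = gen Fin.zero ; t = gen (Fin.suc Fin.zero) ; s = gen (Fin.suc (Fin.suc Fin.zero))
  ; conjugates-square  = conjugates-square
  ; centralises-square = centralises-square
  ; not-centralises    = not-centralises }
  where open Obstruction O

double : ℕ × Bool → ℕ
double (zero , false) = 0
double (zero , true)  = 1
double (suc q , b)    = suc (suc (double (q , b)))

half : ℕ → ℕ × Bool
half zero          = 0 , false
half (suc zero)    = 0 , true
half (suc (suc n)) = map₁ suc (half n)

half-double : ∀ p → half (double p) ≡ p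
half-double (zero , false) = refl
half-double (zero , true)  = refl
half-double (suc q , b)    = cong (map₁ suc) (half-double (q , b))

double-half : ∀ n → double (half n) ≡ n
double-half zero          = refl
double-half (suc zero)    = refl
double-half (suc (suc n)) = cong (λ m → suc (suc m)) (double-half n)

ℕ×Bool↔ℕ : (ℕ × Bool) ↔ ℕ
ℕ×Bool↔ℕ = mk↔ₛ′ double half double-half half-double

doubleℤ : ℤ × Bool → ℤ
doubleℤ (+ n , b)      = + double (n , b)
doubleℤ (-[1+ n ] , b) = -[1+ double (n , not b) ]

halfℤ : ℤ → ℤ × Bool
halfℤ (+ n)      = map₁ +_ (half n)
halfℤ -[1+ n ]   = -[1+ proj₁ (half n) ] , not (proj₂ (half n))

halfℤ-doubleℤ : ∀ p → halfℤ (doubleℤ p) ≡ p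
halfℤ-doubleℤ (+ n , b)      = cong (map₁ +_) (half-double (n , b))
halfℤ-doubleℤ (-[1+ n ] , b) rewrite half-double (n , not b) = cong (-[1+ n ] ,_) (not-involutive b)

doubleℤ-halfℤ : ∀ z → doubleℤ (halfℤ z) ≡ z
doubleℤ-halfℤ (+ n)    = cong +_ (double-half n)
doubleℤ-halfℤ -[1+ n ] rewrite not-involutive (proj₂ (half n)) = cong -[1+_] (double-half n)

doubleℤ-suc : ∀ w b → doubleℤ (ℤ.suc w , b) ≡ ℤ.suc (ℤ.suc (doubleℤ (w , b)))
doubleℤ-suc (+ n)          b     = refl
doubleℤ-suc -[1+ zero ]    false = refl
doubleℤ-suc -[1+ zero ]    true  = refl
doubleℤ-suc -[1+ suc n ]   b     = refl

-- Pairing ℕ × ℕ ≅ ℕ, (k , m) ↦ 2ᵏ(2m + 1) - 1, via binary numerals.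
pair : ℕ × ℕ → ℕᵇ
pair (zero , zero)  = zeroᵇ
pair (zero , suc m) = 2[1+ ℕᵇ.fromℕ m ]
pair (suc k , m)    = 1+[2 pair (k , m) ]

unpair : ℕᵇ → ℕ × ℕ
unpair zeroᵇ     = 0 , 0
unpair 2[1+ x ]  = 0 , suc (ℕᵇ.toℕ x)
unpair 1+[2 x ]  = map₁ suc (unpair x)

unpair-pair : ∀ p → unpair (pair p) ≡ p
unpair-pair (zero , zero)  = refl
unpair-pair (zero , suc m) = cong (λ n → 0 , suc n) (ℕᵇ.toℕ-fromℕ m)
unpair-pair (suc k , m)    = cong (map₁ suc) (unpair-pair (k , m))

pair-unpair : ∀ x → pair (unpair x) ≡ x
pair-unpair zeroᵇ    = refl
pair-unpair 2[1+ x ] = cong 2[1+_] (ℕᵇ.fromℕ-toℕ x)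
pair-unpair 1+[2 x ] = cong 1+[2_] (pair-unpair x)

ℕ×ℕ↔ℕ : (ℕ × ℕ) ↔ ℕ
ℕ×ℕ↔ℕ = ↔-trans (mk↔ₛ′ pair unpair pair-unpair unpair-pair)
                 (mk↔ₛ′ ℕᵇ.toℕ ℕᵇ.fromℕ ℕᵇ.toℕ-fromℕ ℕᵇ.fromℕ-toℕ)

ℤ↔ℕ×Bool : ℤ ↔ (ℕ × Bool)
ℤ↔ℕ×Bool = mk↔ₛ′ split join split-join join-split
  where
  split : ℤ → ℕ × Bool
  split (+ n)    = n , false
  split -[1+ n ] = n , true
  join : ℕ × Bool → ℤ
  join (n , false) = + n
  join (n , true)  = -[1+ n ]
  split-join : ∀ p → split (join p) ≡ p
  split-join (n , false) = refl
  split-join (n , true)  = refl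
  join-split : ∀ z → join (split z) ≡ z
  join-split (+ n)    = refl
  join-split -[1+ n ] = refl

Y : Set
Y = ℤ × ℕ

Y↔ℕ : Y ↔ ℕ
Y↔ℕ = ↔-trans (ℤ↔ℕ ×-↔ ↔-refl) ℕ×ℕ↔ℕ
  where
  ℤ↔ℕ : ℤ ↔ ℕ
  ℤ↔ℕ = ↔-trans ℤ↔ℕ×Bool ℕ×Bool↔ℕ

shift : Perm Y
shift = record
  { to      = map₁ ℤ.suc
  ; from    = map₁ ℤ.pred
  ; to-from = λ p → cong (_, proj₂ p) (ℤ.suc-pred (proj₁ p))
  ; from-to = λ p → cong (_, proj₂ p) (ℤ.pred-suc (proj₁ p)) }

-- t : the copy 2q + b of ℤ is spread over the residues ≡ b (mod 2) of copy q,
-- so that conjugating by t turns the shift by one into the shift by two.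
spread : Perm Y
spread = record
  { to      = spread-to
  ; from    = spread-from
  ; to-from = to-from
  ; from-to = from-to }
  where
  spread-to : Y → Y
  spread-to (z , k) = doubleℤ (z , proj₂ (half k)) , proj₁ (half k)
  spread-from : Y → Y
  spread-from (w , q) = proj₁ (halfℤ w) , double (q , proj₂ (halfℤ w))
  to-from : ∀ p → spread-to (spread-from p) ≡ p
  to-from (w , q) rewrite half-double (q , proj₂ (halfℤ w)) = cong (_, q) (doubleℤ-halfℤ w)
  from-to : ∀ p → spread-from (spread-to p) ≡ p
  from-to (z , k) rewrite halfℤ-doubleℤ (z , proj₂ (half k)) = cong (z ,_) (double-half k)

swap-pairs : ℤ → ℤ
swap-pairs z = doubleℤ (map₂ not (halfℤ z))

swap-pairs-double : ∀ w b → swap-pairs (doubleℤ (w , b)) ≡ doubleℤ (w , not b)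
swap-pairs-double w b = cong (λ p → doubleℤ (map₂ not p)) (halfℤ-doubleℤ (w , b))

swap-pairs-involutive : ∀ z → swap-pairs (swap-pairs z) ≡ z
swap-pairs-involutive z = begin
  swap-pairs (doubleℤ (w , not b)) ≡⟨ swap-pairs-double w (not b) ⟩
  doubleℤ (w , not (not b))        ≡⟨ cong (λ b′ → doubleℤ (w , b′)) (not-involutive b) ⟩
  doubleℤ (w , b)                  ≡⟨ doubleℤ-halfℤ z ⟩
  z                                ∎
  where
  open ≡-Reasoning
  w : ℤ
  w = proj₁ (halfℤ z)
  b : Bool
  b = proj₂ (halfℤ z)

swap-pairs-suc² : ∀ z → swap-pairs (ℤ.suc (ℤ.suc z)) ≡ ℤ.suc (ℤ.suc (swap-pairs z))
swap-pairs-suc² z = begin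
  swap-pairs (ℤ.suc (ℤ.suc z))                   ≡⟨ cong (λ z′ → swap-pairs (ℤ.suc (ℤ.suc z′))) (doubleℤ-halfℤ z) ⟨
  swap-pairs (ℤ.suc (ℤ.suc (doubleℤ (w , b))))   ≡⟨ cong swap-pairs (doubleℤ-suc w b) ⟨
  swap-pairs (doubleℤ (ℤ.suc w , b))             ≡⟨ swap-pairs-double (ℤ.suc w) b ⟩
  doubleℤ (ℤ.suc w , not b)                      ≡⟨ doubleℤ-suc w (not b) ⟩
  ℤ.suc (ℤ.suc (doubleℤ (w , not b)))            ≡⟨ cong (λ z′ → ℤ.suc (ℤ.suc z′)) (swap-pairs-double w b) ⟨
  ℤ.suc (ℤ.suc (swap-pairs (doubleℤ (w , b))))   ≡⟨ cong (λ z′ → ℤ.suc (ℤ.suc (swap-pairs z′))) (doubleℤ-halfℤ z) ⟩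
  ℤ.suc (ℤ.suc (swap-pairs z))                   ∎
  where
  open ≡-Reasoning
  w : ℤ
  w = proj₁ (halfℤ z)
  b : Bool
  b = proj₂ (halfℤ z)

swap : Perm Y
swap = record
  { to      = map₁ swap-pairs
  ; from    = map₁ swap-pairs
  ; to-from = λ p → cong (_, proj₂ p) (swap-pairs-involutive (proj₁ p))
  ; from-to = λ p → cong (_, proj₂ p) (swap-pairs-involutive (proj₁ p)) }

Sym-obstruction : Obstruction (Sym Y)
Sym-obstruction = record
  { a = shift ; t = spread ; s = swap
  ; conjugates-square  = λ (z , k) → cong (_, proj₁ (half k)) (doubleℤ-suc z (proj₂ (half k)))
  ; centralises-square = λ (z , k) → cong (_, k) (swap-pairs-suc² z)
  ; not-centralises    = λ sa≈as → 0≢2 (cong proj₁ (sa≈as (+ 0 , 0))) }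
  where
  -- at (0 , 0): s a sends it to (0 , 0) but a s to (2 , 0)
  0≢2 : ¬ (+ 0 ≡ + 2)
  0≢2 ()

Sym-countable-not-embeddable : (X : Set) → X ↔ ℕ → (c ℓ : Level) →
                               ¬ EmbedsInPseudofinite c ℓ (Sym X)
Sym-countable-not-embeddable X X↔ℕ = obstruction⇒¬embeds
  (obstruction-transport {H = Sym Y} {G = Sym X} (Sym-embedding X↔Y) Sym-obstruction)
  where
  X↔Y : X ↔ Y
  X↔Y = ↔-trans X↔ℕ (↔-sym Y↔ℕ)

theorem6p0p4 : ((X : Set) → X ↔ ℕ → (c ℓ : Level) → ¬ EmbedsInPseudofinite c ℓ (Sym X))
    ×ω
    Σω (Group 0ℓ 0ℓ) (λ H → FinitelyGenerated H
        ∧ω ((c ℓ : Level) → ¬ EmbedsInPseudofinite c ℓ H))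
theorem6p0p4 =
  Sym-countable-not-embeddable
  ,ω (Generated (Sym Y) (obstruction-triple Sym-obstruction)
  ,ω (Generated-finitelyGenerated (Sym Y) (obstruction-triple Sym-obstruction)
  ,ω obstruction⇒¬embeds (obstruction-generated Sym-obstruction)))
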